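{- Let $n\ge1$, $p$ a prime, $k=\overline{\mathbf{F}}_p$, and $\Sigma_1=\{(i,j)\in\{1,\dots,n\}^2: i\ge j\}\cup\{(i,n+1-i):1\le i\le n\}$. Then $\Sigma_1$ is large: there is a nonempty Zariski open subset $U\subset M_n(k)$ such that for every $x\in U$ there exists an invertible lower-triangular matrix $b\in GL_n(k)$ with $bx\varphi(b)^{ -1}\in M_{\Sigma_1}$.
   Context: $\varphi$ denotes the map raising every matrix entry to the $p$-th power. For $\Sigma\subset\{1,\dots,n\}^2$, $M_\Sigma\subset M_n(k)$ is the closed subset of matrices $(m_{i,j})$ with $m_{i,j}=0$ for all $(i,j)\notin\Sigma$. -}

module Defs where

open import Level using (Level; _⊔_) renaming (suc to lsuc)
open import Algebra.Bundles using (CommutativeRing)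
open import Data.Nat as N using (ℕ; zero; suc)
open import Data.Fin using (Fin; toℕ)
open import Data.List using (List; []; _∷_)
open import Data.List.Relation.Unary.Any using (Any)
open import Data.Product using (Σ; ∃; _×_; _,_)
open import Data.Sum using (_⊎_)
open import Relation.Nullary using (¬_; yes; no)
open import Data.Fin as F using ()
open import Relation.Binary.PropositionalEquality using (_≡_)

Mat : ∀ {a} → Set a → ℕ → Set a
Mat A n = Fin n → Fin n → A

-- The index set Σ₁ (0-based): i ≥ j, or (i,j) antidiagonal, i.e. (i+1)+(j+1) = n+1.
Σ₁ : (n : ℕ) → Fin n → Fin n → Set
Σ₁ n i j = (toℕ j N.≤ toℕ i) ⊎ (suc (toℕ i + toℕ j) ≡ n)
  where open N using (_+_)

data Poly {c} (A : Set c) (V : Set) : Set c where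
  var  : V → Poly A V
  con  : A → Poly A V
  _⊕_  : Poly A V → Poly A V → Poly A V
  _⊗_  : Poly A V → Poly A V → Poly A V
  ⊝_   : Poly A V → Poly A V

module FieldTheory {c ℓ : Level} (R : CommutativeRing c ℓ) where
  open CommutativeRing R

  pow : Carrier → ℕ → Carrier
  pow x zero    = 1#
  pow x (suc m) = x * pow x m

  natMul : ℕ → Carrier
  natMul zero    = 0#
  natMul (suc m) = 1# + natMul m

  IsField : Set (c ⊔ ℓ)
  IsField = (¬ (1# ≈ 0#)) × (∀ x → ¬ (x ≈ 0#) → ∃ λ y → (x * y) ≈ 1#)

  -- evaluation of a one-variable monic polynomial x^d + a_{d-1} x^{d-1} + ... + a_0,
  -- coefficients given as the list a_0 ∷ a_1 ∷ ... ∷ a_{d-1} (so d = length).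
  evalMonic : List Carrier → Carrier → Carrier
  evalMonic []       x = 1#
  evalMonic (a ∷ as) x = a + x * evalMonic as x

  IsAlgClosed : Set (c ⊔ ℓ)
  IsAlgClosed = ∀ (a : Carrier) (as : List Carrier) → ∃ λ x → evalMonic (a ∷ as) x ≈ 0#

  -- k is (isomorphic to) the algebraic closure of F_p: a field of characteristic p,
  -- algebraically closed, and algebraic over F_p (every x satisfies x^(p^m) = x, m ≥ 1).
  IsAlgClosureFp : ℕ → Set (c ⊔ ℓ)
  IsAlgClosureFp p = IsField × (natMul p ≈ 0#) × IsAlgClosed
                   × (∀ x → ∃ λ m → (1 N.≤ m) × (pow x (p N.^ m) ≈ x))

  sumF : (n : ℕ) → (Fin n → Carrier) → Carrier
  sumF zero    f = 0#
  sumF (suc n) f = f F.zero + sumF n (λ i → f (F.suc i))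

  _⊠_ : ∀ {n} → Mat Carrier n → Mat Carrier n → Mat Carrier n
  _⊠_ {n} A B i j = sumF n (λ l → A i l * B l j)

  idM : ∀ {n} → Mat Carrier n
  idM i j with i F.≟ j
  ... | yes _ = 1#
  ... | no  _ = 0#

  _≈M_ : ∀ {n} → Mat Carrier n → Mat Carrier n → Set ℓ
  A ≈M B = ∀ i j → A i j ≈ B i j

  IsInverse : ∀ {n} → Mat Carrier n → Mat Carrier n → Set ℓ
  IsInverse A B = ((A ⊠ B) ≈M idM) × ((B ⊠ A) ≈M idM)

  Invertible : ∀ {n} → Mat Carrier n → Set (c ⊔ ℓ)
  Invertible A = ∃ λ B → IsInverse A B

  LowerTriangular : ∀ {n} → Mat Carrier n → Set ℓ
  LowerTriangular A = ∀ i j → toℕ i N.< toℕ j → A i j ≈ 0#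

  φ : ℕ → ∀ {n} → Mat Carrier n → Mat Carrier n
  φ p A i j = pow (A i j) p

  InM : ∀ {n} → (Fin n → Fin n → Set) → Mat Carrier n → Set ℓ
  InM S A = ∀ i j → ¬ S i j → A i j ≈ 0#

  evalP : ∀ {n} → Poly Carrier (Fin n × Fin n) → Mat Carrier n → Carrier
  evalP (var (i , j)) x = x i j
  evalP (con a)       x = a
  evalP (f ⊕ g)       x = evalP f x + evalP g x
  evalP (f ⊗ g)       x = evalP f x * evalP g x
  evalP (⊝ f)         x = - evalP f x

  -- Zariski open subset of M_n(k): complement of the common zero locus of
  -- finitely many polynomials fs (every Zariski closed set is of this form).
  InOpen : ∀ {n} → List (Poly Carrier (Fin n × Fin n)) → Mat Carrier n → Set (c ⊔ ℓ)
  InOpen fs x = Any (λ f → ¬ (evalP f x ≈ 0#)) fs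

  IsLarge : ℕ → (n : ℕ) → (Fin n → Fin n → Set) → Set (c ⊔ ℓ)
  IsLarge p n S =
    Σ (List (Poly Carrier (Fin n × Fin n))) λ fs →
      (∃ λ x → InOpen fs x) ×
      (∀ x → InOpen fs x →
        ∃ λ b → LowerTriangular b × Invertible b ×
          ∃ λ d → IsInverse (φ p b) d × InM S ((b ⊠ x) ⊠ d))

-- Induct on n in steps of two. Split the indices of x into the first one, the m middle ones and the
-- last one, and assume the corner entry a = x₀,ₙ₋₁ is nonzero. Conjugating by the lower-triangular
-- b = [[1,0,0],[t,c,0],[0,β,γ]] with γ^p = a, β^p = the middle of the first row of x, and t chosen to
-- clear the middle of the last column of b x, the twisted conjugate b x φ(b)⁻¹ has zero middle first
-- row and zero middle last column, and its middle block is a⁻¹ c M φ(c)⁻¹, where M is the m×m matrix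
-- of 2×2 minors through the corner. So the case n = m + 2 reduces to the case m applied to M, and the
-- open set is cut out by a · f(M) when f cuts out the open set for m.
module Submission where

open import Level using (Level; _⊔_)
open import Algebra.Bundles using (CommutativeRing)
open import Data.Nat as ℕ using (ℕ; zero; suc; _≤_; z≤n; s≤s)
import Data.Nat.Properties as ℕₚ
open import Data.Nat.Primality using (Prime; ¬prime[0])
open import Data.Fin using (Fin; zero; suc; toℕ; inject₁; fromℕ; _≟_)
open import Data.Fin.Properties using (suc-injective; toℕ-inject₁; toℕ-fromℕ; toℕ<n; toℕ≤pred[n])
open import Data.Fin.Relation.Unary.Top using (view; ‵fromℕ; ‵inject₁; view-fromℕ; view-inject₁)
open import Data.Vec.Functional using (Vector)
open import Data.List using (replicate; []; _∷_)
open import Data.List.Relation.Unary.Any using (here)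
open import Data.Product using (∃; _×_; _,_; proj₁; proj₂)
open import Data.Sum using (inj₁; inj₂)
open import Data.Empty using (⊥-elim)
open import Function using (_∘_)
open import Relation.Nullary using (¬_; yes; no)
open import Relation.Binary.PropositionalEquality as ≡ using (_≡_; _≢_)

open import Defs

data Part (m : ℕ) : Set where
  first : Part m
  mid   : Fin m → Part m
  last  : Part m

toPart : ∀ {m} → Fin (suc (suc m)) → Part m
toPart zero = first
toPart (suc i) with view i
... | ‵fromℕ     = last
... | ‵inject₁ r = mid r

fromPart : ∀ {m} → Part m → Fin (suc (suc m))
fromPart first   = zero
fromPart (mid r) = suc (inject₁ r)
fromPart last    = suc (fromℕ _)

fromPart-toPart : ∀ {m} (i : Fin (suc (suc m))) → fromPart (toPart i) ≡ i
fromPart-toPart zero = ≡.refl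
fromPart-toPart (suc i) with view i
... | ‵fromℕ     = ≡.refl
... | ‵inject₁ r = ≡.refl

toPart-fromPart : ∀ {m} (u : Part m) → toPart (fromPart u) ≡ u
toPart-fromPart first = ≡.refl
toPart-fromPart (mid r) rewrite view-inject₁ r = ≡.refl
toPart-fromPart {m} last rewrite view-fromℕ m = ≡.refl

fromPart-injective : ∀ {m} {u v : Part m} → fromPart u ≡ fromPart v → u ≡ v
fromPart-injective {u = u} {v} e =
  ≡.trans (≡.sym (toPart-fromPart u)) (≡.trans (≡.cong toPart e) (toPart-fromPart v))

mid-injective : ∀ {m} {k l : Fin m} → mid k ≡ mid l → k ≡ l
mid-injective ≡.refl = ≡.refl

fromPart-mid-< : ∀ {m} {k l : Fin m} → toℕ (fromPart (mid k)) ℕ.< toℕ (fromPart (mid l)) → toℕ k ℕ.< toℕ l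
fromPart-mid-< {k = k} {l} lt = ≡.subst₂ ℕ._<_ (toℕ-inject₁ k) (toℕ-inject₁ l) (ℕ.s<s⁻¹ lt)

fromPart-last-≮ : ∀ {m} (v : Part m) → ¬ toℕ (fromPart {m} last) ℕ.< toℕ (fromPart v)
fromPart-last-≮ {m} (mid l) lt = ℕₚ.<⇒≱ (toℕ<n l)
  (≡.subst₂ ℕ._≤_ (toℕ-fromℕ m) (toℕ-inject₁ l) (ℕₚ.<⇒≤ (ℕ.s<s⁻¹ lt)))
fromPart-last-≮ last lt = ℕₚ.<-irrefl ≡.refl lt

Σ₁-first-column : ∀ {m} (u : Part m) → Σ₁ (suc (suc m)) (fromPart u) zero
Σ₁-first-column u = inj₁ z≤n

Σ₁-corner : ∀ {m} → Σ₁ (suc (suc m)) zero (fromPart {m} last)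
Σ₁-corner {m} = inj₂ (≡.cong (λ n → suc (suc n)) (toℕ-fromℕ m))

Σ₁-last-row : ∀ {m} (v : Part m) → Σ₁ (suc (suc m)) (fromPart last) (fromPart v)
Σ₁-last-row {m} v =
  inj₁ (≡.subst (toℕ (fromPart v) ℕ.≤_) (≡.cong suc (≡.sym (toℕ-fromℕ m))) (toℕ≤pred[n] (fromPart v)))

Σ₁-mid : ∀ {m} {k l : Fin m} → Σ₁ m k l → Σ₁ (suc (suc m)) (fromPart (mid k)) (fromPart (mid l))
Σ₁-mid {k = k} {l} (inj₁ le) =
  inj₁ (s≤s (≡.subst₂ ℕ._≤_ (≡.sym (toℕ-inject₁ l)) (≡.sym (toℕ-inject₁ k)) le))
Σ₁-mid {k = k} {l} (inj₂ e) rewrite toℕ-inject₁ k | toℕ-inject₁ l | ℕₚ.+-suc (toℕ k) (toℕ l) =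
  inj₂ (≡.cong (λ n → suc (suc n)) e)

module _ {c ℓ : Level} (R : CommutativeRing c ℓ) where

  open CommutativeRing R hiding (zero)
  open FieldTheory R
  open import Algebra.Properties.CommutativeSemigroup +-commutativeSemigroup
    using (interchange) renaming (x∙yz≈y∙xz to x+[y+z]≈y+[x+z])
  open import Algebra.Properties.CommutativeSemigroup *-commutativeSemigroup
    using () renaming (x∙yz≈y∙xz to x*[y*z]≈y*[x*z])
  open import Algebra.Properties.Ring ring
    using (-‿distribˡ-*; -‿distribʳ-*; -0#≈0#; -‿+-comm; +-inverseʳ-unique; -‿involutive)
  open import Algebra.Properties.Semiring.Sum semiring
    using ( sum; sum-syntax; sum-cong-≋; sum-replicate-zero; sum-init-last
          ; ∑-distrib-+; ∑-comm; *-distribˡ-sum; *-distribʳ-sum)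
  open import Relation.Binary.Reasoning.Setoid setoid

  sumF≡sum : ∀ n (f : Fin n → Carrier) → sumF n f ≡ sum f
  sumF≡sum zero    f = ≡.refl
  sumF≡sum (suc n) f = ≡.cong (f zero +_) (sumF≡sum n (f ∘ suc))

  sum-zero : ∀ {n} {f : Fin n → Carrier} → (∀ i → f i ≈ 0#) → sum f ≈ 0#
  sum-zero {n} f≈0 = trans (sum-cong-≋ f≈0) (sum-replicate-zero n)

  sum-neg : ∀ {n} (f : Fin n → Carrier) → sum (λ i → - f i) ≈ - sum f
  sum-neg {zero}  f = sym -0#≈0#
  sum-neg {suc n} f = trans (+-congˡ (sum-neg (f ∘ suc))) (-‿+-comm (f zero) _)

  sum-*-negʳ : ∀ {n} (f g : Vector Carrier n) → ∑[ s < n ] (f s * - g s) ≈ - ∑[ s < n ] (f s * g s)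
  sum-*-negʳ f g = trans (sum-cong-≋ λ s → sym (-‿distribʳ-* (f s) (g s))) (sum-neg (λ s → f s * g s))

  sum-neg-scaled-* : ∀ {n} a (f g : Vector Carrier n) →
                     ∑[ s < n ] ((- (a * f s)) * g s) ≈ - (a * ∑[ s < n ] (f s * g s))
  sum-neg-scaled-* {n} a f g = begin
    ∑[ s < n ] ((- (a * f s)) * g s)
      ≈⟨ sum-cong-≋ (λ s → trans (sym (-‿distribˡ-* _ _)) (-‿cong (*-assoc a (f s) (g s)))) ⟩
    ∑[ s < n ] (- (a * (f s * g s)))  ≈⟨ sum-neg (λ s → a * (f s * g s)) ⟩
    - ∑[ s < n ] (a * (f s * g s))    ≈⟨ -‿cong (*-distribˡ-sum a (λ s → f s * g s)) ⟨
    - (a * ∑[ s < n ] (f s * g s))    ∎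

  mulCol : ∀ {m} → Mat Carrier m → Vector Carrier m → Vector Carrier m
  mulCol C T k = sum λ s → C k s * T s

  mulRow : ∀ {m} → Vector Carrier m → Mat Carrier m → Vector Carrier m
  mulRow v C l = sum λ s → v s * C s l

  dot : ∀ {m} → Vector Carrier m → Vector Carrier m → Carrier
  dot v T = sum λ s → v s * T s

  ⊠≡mulRow : ∀ {m} (A B : Mat Carrier m) k l → (A ⊠ B) k l ≡ mulRow (A k) B l
  ⊠≡mulRow {m} A B k l = sumF≡sum m _

  dot-mulRow : ∀ {m} v (C : Mat Carrier m) T → dot (mulRow v C) T ≈ dot v (mulCol C T)
  dot-mulRow {m} v C T = begin
    ∑[ r < m ] ((∑[ s < m ] (v s * C s r)) * T r)
      ≈⟨ sum-cong-≋ (λ r → *-distribʳ-sum (T r) (λ s → v s * C s r)) ⟩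
    ∑[ r < m ] (∑[ s < m ] ((v s * C s r) * T r))
      ≈⟨ ∑-comm (λ r s → (v s * C s r) * T r) ⟩
    ∑[ s < m ] (∑[ r < m ] ((v s * C s r) * T r))
      ≈⟨ sum-cong-≋ (λ s → sum-cong-≋ (λ r → *-assoc (v s) (C s r) (T r))) ⟩
    ∑[ s < m ] (∑[ r < m ] (v s * (C s r * T r)))
      ≈⟨ sum-cong-≋ (λ s → *-distribˡ-sum (v s) (λ r → C s r * T r)) ⟨
    ∑[ s < m ] (v s * ∑[ r < m ] (C s r * T r))
      ∎


  mulCol-⊠ : ∀ {m} (A B : Mat Carrier m) T k → mulCol (A ⊠ B) T k ≈ mulCol A (mulCol B T) k
  mulCol-⊠ A B T k = trans (sum-cong-≋ (λ r → *-congʳ (reflexive (⊠≡mulRow A B k r)))) (dot-mulRow (A k) B T)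

  mulRow-⊠ : ∀ {m} v (A B : Mat Carrier m) l → mulRow v (A ⊠ B) l ≈ mulRow (mulRow v A) B l
  mulRow-⊠ v A B l =
    trans (sum-cong-≋ (λ s → *-congˡ (reflexive (⊠≡mulRow A B s l)))) (sym (dot-mulRow v A (λ r → B r l)))

  idM-refl : ∀ {n} (i : Fin n) → idM i i ≈ 1#
  idM-refl i with i ≟ i
  ... | yes _  = refl
  ... | no i≢i = ⊥-elim (i≢i ≡.refl)

  idM-≢ : ∀ {n} {i j : Fin n} → i ≢ j → idM i j ≈ 0#
  idM-≢ {i = i} {j} i≢j with i ≟ j
  ... | yes i≡j = ⊥-elim (i≢j i≡j)
  ... | no _    = refl

  idM-reindex : ∀ {n n'} {i j : Fin n} {i' j' : Fin n'} → (i ≡ j → i' ≡ j') → (i' ≡ j' → i ≡ j) →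
                idM i j ≈ idM i' j'
  idM-reindex {i = i} {j} {i'} {j'} to from with i ≟ j
  ... | yes i≡j = sym (trans (reflexive (≡.cong (idM i') (≡.sym (to i≡j)))) (idM-refl i'))
  ... | no i≢j  = sym (idM-≢ (i≢j ∘ from))

  mulCol-idM : ∀ {n} (T : Vector Carrier n) k → mulCol idM T k ≈ T k
  mulCol-idM {suc n} T zero = trans (+-cong head≈ (sum-zero tail≈0)) (+-identityʳ (T zero))
    where
    head≈ : idM {suc n} zero zero * T zero ≈ T zero
    head≈ = trans (*-congʳ (idM-refl {suc n} zero)) (*-identityˡ _)
    tail≈0 : ∀ s → idM zero (suc s) * T (suc s) ≈ 0#
    tail≈0 s = trans (*-congʳ (idM-≢ {i = zero} {suc s} λ ())) (zeroˡ _)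
  mulCol-idM {suc n} T (suc k) = trans (+-cong head≈0 tail≈) (+-identityˡ (T (suc k)))
    where
    head≈0 : idM (suc k) zero * T zero ≈ 0#
    head≈0 = trans (*-congʳ (idM-≢ {i = suc k} {zero} λ ())) (zeroˡ _)
    tail≈ : ∑[ s < n ] (idM (suc k) (suc s) * T (suc s)) ≈ T (suc k)
    tail≈ = trans (sum-cong-≋ λ s → *-congʳ (idM-reindex {i = suc k} {suc s} suc-injective (≡.cong suc)))
                  (mulCol-idM (T ∘ suc) k)

  mulRow-idM : ∀ {n} (v : Vector Carrier n) l → mulRow v idM l ≈ v l
  mulRow-idM v l =
    trans (sum-cong-≋ λ s → trans (*-comm _ _) (*-congʳ (idM-reindex {i = s} {l} ≡.sym ≡.sym))) (mulCol-idM v l)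

  mulCol-inverse : ∀ {m} {C Ci : Mat Carrier m} → (C ⊠ Ci) ≈M idM → ∀ T k → mulCol C (mulCol Ci T) k ≈ T k
  mulCol-inverse {C = C} {Ci} CCi T k =
    trans (sym (mulCol-⊠ C Ci T k)) (trans (sum-cong-≋ λ r → *-congʳ (CCi k r)) (mulCol-idM T k))

  mulRow-inverse : ∀ {m} {C Ci : Mat Carrier m} → (Ci ⊠ C) ≈M idM → ∀ v l → mulRow (mulRow v Ci) C l ≈ v l
  mulRow-inverse {C = C} {Ci} CiC v l =
    trans (sym (mulRow-⊠ v Ci C l)) (trans (sum-cong-≋ λ s → *-congˡ (CiC s l)) (mulRow-idM v l))

  ⊠-cong : ∀ {n} {A A' B B' : Mat Carrier n} → A ≈M A' → B ≈M B' → (A ⊠ B) ≈M (A' ⊠ B')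
  ⊠-cong {n} {A} {A'} {B} {B'} A≈A' B≈B' i j = begin
    (A ⊠ B) i j      ≡⟨ ⊠≡mulRow A B i j ⟩
    mulRow (A i) B j  ≈⟨ sum-cong-≋ (λ l → *-cong (A≈A' i l) (B≈B' l j)) ⟩
    mulRow (A' i) B' j ≡⟨ ⊠≡mulRow A' B' i j ⟨
    (A' ⊠ B') i j    ∎

  IsInverse-respˡ : ∀ {n} {A A' B : Mat Carrier n} → A ≈M A' → IsInverse A' B → IsInverse A B
  IsInverse-respˡ {B = B} A≈A' (A'B , BA') =
    (λ i j → trans (⊠-cong {B = B} A≈A' (λ _ _ → refl) i j) (A'B i j)) ,
    (λ i j → trans (⊠-cong {A = B} (λ _ _ → refl) A≈A' i j) (BA' i j))

  InM-resp : ∀ {n} {S : Fin n → Fin n → Set} {A B : Mat Carrier n} → A ≈M B → InM S B → InM S A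
  InM-resp A≈B B∈S i j ∉S = trans (A≈B i j) (B∈S i j ∉S)

  -- Matrices in block form with respect to the first, middle and last indices

  BMat : ℕ → Set c
  BMat m = Part m → Part m → Carrier

  infix 4 _≈ᴮ_
  _≈ᴮ_ : ∀ {m} → BMat m → BMat m → Set ℓ
  A ≈ᴮ B = ∀ u v → A u v ≈ B u v

  unblock : ∀ {m} → BMat m → Mat Carrier (suc (suc m))
  unblock B i j = B (toPart i) (toPart j)

  blocks : ∀ {m} → Mat Carrier (suc (suc m)) → BMat m
  blocks x u v = x (fromPart u) (fromPart v)

  unblock-blocks : ∀ {m} (x : Mat Carrier (suc (suc m))) → unblock (blocks x) ≈M x
  unblock-blocks x i j = reflexive (≡.cong₂ x (fromPart-toPart i) (fromPart-toPart j))

  unblock-fromPart : ∀ {m} (B : BMat m) u v → unblock B (fromPart u) (fromPart v) ≡ B u v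
  unblock-fromPart B u v = ≡.cong₂ B (toPart-fromPart u) (toPart-fromPart v)

  blocks-unblock : ∀ {m} (B : BMat m) → blocks (unblock B) ≈ᴮ B
  blocks-unblock B u v = reflexive (unblock-fromPart B u v)

  unblock-cong : ∀ {m} {A B : BMat m} → A ≈ᴮ B → unblock A ≈M unblock B
  unblock-cong A≈B i j = A≈B (toPart i) (toPart j)

  unblock-all : ∀ {m q} (P : Fin (suc (suc m)) → Fin (suc (suc m)) → Carrier → Set q) (B : BMat m) →
                (∀ u v → P (fromPart u) (fromPart v) (B u v)) → ∀ i j → P i j (unblock B i j)
  unblock-all P B h i j =
    ≡.subst₂ (λ i' j' → P i' j' (unblock B i j)) (fromPart-toPart i) (fromPart-toPart j) (h (toPart i) (toPart j))

  infixl 7 _⊡_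
  _⊡_ : ∀ {m} → BMat m → BMat m → BMat m
  (A ⊡ B) u v = A u first * B first v + (∑[ s < _ ] (A u (mid s) * B (mid s) v) + A u last * B last v)

  sum-parts : ∀ {m} (g : Part m → Carrier) →
              ∑[ i < suc (suc m) ] g (toPart i) ≈ g first + (∑[ s < m ] g (mid s) + g last)
  sum-parts g = +-congˡ (trans (sum-init-last (g ∘ toPart ∘ suc))
    (+-cong (sum-cong-≋ λ s → reflexive (≡.cong g (toPart-fromPart (mid s))))
            (reflexive (≡.cong g (toPart-fromPart last)))))

  unblock-⊡ : ∀ {m} (A B : BMat m) → (unblock A ⊠ unblock B) ≈M unblock (A ⊡ B)
  unblock-⊡ {m} A B i j = trans (reflexive (sumF≡sum (suc (suc m)) (λ l → unblock A i l * unblock B l j)))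
                                (sum-parts (λ w → A (toPart i) w * B w (toPart j)))

  1ᴮ : ∀ {m} → BMat m
  1ᴮ first   first   = 1#
  1ᴮ (mid k) (mid l) = idM k l
  1ᴮ last    last    = 1#
  1ᴮ _       _       = 0#

  idM-fromPart-≢ : ∀ {m} (u v : Part m) → u ≢ v → idM (fromPart u) (fromPart v) ≈ 0#
  idM-fromPart-≢ u v u≢v = idM-≢ (u≢v ∘ fromPart-injective)

  1ᴮ≈idM-fromPart : ∀ {m} (u v : Part m) → 1ᴮ u v ≈ idM (fromPart u) (fromPart v)
  1ᴮ≈idM-fromPart {m} first   first   = sym (idM-refl {suc (suc m)} zero)
  1ᴮ≈idM-fromPart     first   (mid l) = sym (idM-fromPart-≢ first (mid l) λ ())
  1ᴮ≈idM-fromPart {m} first   last    = sym (idM-fromPart-≢ {m} first last λ ())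
  1ᴮ≈idM-fromPart     (mid k) first   = sym (idM-fromPart-≢ (mid k) first λ ())
  1ᴮ≈idM-fromPart     (mid k) (mid l) = idM-reindex {i = k} {l} {fromPart (mid k)} {fromPart (mid l)}
                                                      (≡.cong (fromPart ∘ mid)) (mid-injective ∘ fromPart-injective)
  1ᴮ≈idM-fromPart     (mid k) last    = sym (idM-fromPart-≢ (mid k) last λ ())
  1ᴮ≈idM-fromPart {m} last    first   = sym (idM-fromPart-≢ {m} last first λ ())
  1ᴮ≈idM-fromPart     last    (mid l) = sym (idM-fromPart-≢ last (mid l) λ ())
  1ᴮ≈idM-fromPart {m} last    last    = sym (idM-refl (fromPart {m} last))

  unblock-1ᴮ : ∀ {m} → unblock (1ᴮ {m}) ≈M idM
  unblock-1ᴮ = unblock-all (λ i j y → y ≈ idM i j) 1ᴮ 1ᴮ≈idM-fromPart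

  IsInverseᴮ : ∀ {m} → BMat m → BMat m → Set ℓ
  IsInverseᴮ A B = (A ⊡ B ≈ᴮ 1ᴮ) × (B ⊡ A ≈ᴮ 1ᴮ)

  unblock-inverse : ∀ {m} {A B : BMat m} → IsInverseᴮ A B → IsInverse (unblock A) (unblock B)
  unblock-inverse {A = A} {B} (AB , BA) =
    (λ i j → trans (unblock-⊡ A B i j) (trans (AB (toPart i) (toPart j)) (unblock-1ᴮ i j))) ,
    (λ i j → trans (unblock-⊡ B A i j) (trans (BA (toPart i) (toPart j)) (unblock-1ᴮ i j)))

  lowerBlock : ∀ {m} → Vector Carrier m → Mat Carrier m → Carrier → Vector Carrier m → Carrier → BMat m
  lowerBlock T C u v w first   first   = 1#
  lowerBlock T C u v w first   _       = 0#
  lowerBlock T C u v w (mid k) first   = T k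
  lowerBlock T C u v w (mid k) (mid l) = C k l
  lowerBlock T C u v w (mid k) last    = 0#
  lowerBlock T C u v w last    first   = u
  lowerBlock T C u v w last    (mid l) = v l
  lowerBlock T C u v w last    last    = w

  lowerBlock⁻¹ : ∀ {m} → Vector Carrier m → Mat Carrier m → Carrier → Vector Carrier m → Carrier → BMat m
  lowerBlock⁻¹ T Ci u v wi =
    lowerBlock (λ k → - mulCol Ci T k) Ci (wi * (- u + dot v (mulCol Ci T))) (λ l → - (wi * mulRow v Ci l)) wi

  lowerBlock-first-row : ∀ {m} T C u v w (y : Part m) → lowerBlock T C u v w first y ≡ 1ᴮ first y
  lowerBlock-first-row T C u v w first   = ≡.refl
  lowerBlock-first-row T C u v w (mid l) = ≡.refl
  lowerBlock-first-row T C u v w last    = ≡.refl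

  lowerBlock-⊡-first : ∀ {m} T C u v w (B : BMat m) y → (lowerBlock T C u v w ⊡ B) first y ≈ B first y
  lowerBlock-⊡-first {m} T C u v w B y = trans
    (+-cong (*-identityˡ _) (trans (+-cong (sum-zero {m} λ s → zeroˡ _) (zeroˡ _)) (+-identityˡ 0#)))
    (+-identityʳ _)

  ⊡-lowerBlock-mid : ∀ {m} (A : BMat m) T C u v w y l →
                     (A ⊡ lowerBlock T C u v w) y (mid l) ≈ mulRow (λ s → A y (mid s)) C l + A y last * v l
  ⊡-lowerBlock-mid A T C u v w y l = trans (+-congʳ (zeroʳ _)) (+-identityˡ _)

  ⊡-lowerBlock-last : ∀ {m} (A : BMat m) T C u v w y → (A ⊡ lowerBlock T C u v w) y last ≈ A y last * w
  ⊡-lowerBlock-last {m} A T C u v w y = trans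
    (+-cong (zeroʳ _) (trans (+-congʳ (sum-zero {m} λ s → zeroʳ _)) (+-identityˡ _)))
    (+-identityˡ _)

  module _ {m} (T : Vector Carrier m) {C Ci : Mat Carrier m} (u : Carrier) (v : Vector Carrier m) {w wi : Carrier}
           (CCi : (C ⊠ Ci) ≈M idM) (CiC : (Ci ⊠ C) ≈M idM) (wwi : w * wi ≈ 1#) where

    private
      L L⁻¹ : BMat m
      L   = lowerBlock T C u v w
      L⁻¹ = lowerBlock⁻¹ T Ci u v wi
      T⁻ : Vector Carrier m
      T⁻ k = - mulCol Ci T k
      v⁻ : Vector Carrier m
      v⁻ l = - (wi * mulRow v Ci l)
      u⁻ : Carrier
      u⁻ = wi * (- u + dot v (mulCol Ci T))
      D : Carrier
      D = dot v (mulCol Ci T)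

      cancel-w : ∀ z → w * (wi * z) ≈ z
      cancel-w z = trans (sym (*-assoc w wi z)) (trans (*-congʳ wwi) (*-identityˡ z))

    lowerBlock-⊡-lowerBlock⁻¹ : L ⊡ L⁻¹ ≈ᴮ 1ᴮ
    lowerBlock-⊡-lowerBlock⁻¹ first y =
      trans (lowerBlock-⊡-first T C u v w L⁻¹ y) (reflexive (lowerBlock-first-row T⁻ Ci u⁻ v⁻ wi y))
    lowerBlock-⊡-lowerBlock⁻¹ (mid k) first = begin
      T k * 1# + (mulCol C (λ s → - mulCol Ci T s) k + 0# * _)
        ≈⟨ +-cong (*-identityʳ _) (trans (+-cong (sum-*-negʳ (C k) (mulCol Ci T)) (zeroˡ _)) (+-identityʳ _)) ⟩
      T k + - mulCol C (mulCol Ci T) k  ≈⟨ +-congˡ (-‿cong (mulCol-inverse CCi T k)) ⟩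
      T k + - T k                       ≈⟨ -‿inverseʳ (T k) ⟩
      0# ∎
    lowerBlock-⊡-lowerBlock⁻¹ (mid k) (mid l) = begin
      (L ⊡ L⁻¹) (mid k) (mid l)  ≈⟨ ⊡-lowerBlock-mid L T⁻ Ci u⁻ v⁻ wi (mid k) l ⟩
      mulRow (C k) Ci l + 0# * _  ≈⟨ +-cong (reflexive (≡.sym (⊠≡mulRow C Ci k l))) (zeroˡ _) ⟩
      (C ⊠ Ci) k l + 0#           ≈⟨ trans (+-identityʳ _) (CCi k l) ⟩
      idM k l ∎
    lowerBlock-⊡-lowerBlock⁻¹ (mid k) last = trans (⊡-lowerBlock-last L T⁻ Ci u⁻ v⁻ wi (mid k)) (zeroˡ wi)
    lowerBlock-⊡-lowerBlock⁻¹ last first = begin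
      u * 1# + (dot v (λ s → - mulCol Ci T s) + w * (wi * (- u + D)))
        ≈⟨ +-cong (*-identityʳ u) (+-cong (sum-*-negʳ v (mulCol Ci T)) (cancel-w _)) ⟩
      u + (- D + (- u + D))  ≈⟨ +-congˡ (x+[y+z]≈y+[x+z] (- D) (- u) D) ⟩
      u + (- u + (- D + D))  ≈⟨ +-congˡ (trans (+-congˡ (-‿inverseˡ D)) (+-identityʳ _)) ⟩
      u + - u                ≈⟨ -‿inverseʳ u ⟩
      0# ∎
    lowerBlock-⊡-lowerBlock⁻¹ last (mid l) = begin
      (L ⊡ L⁻¹) last (mid l)  ≈⟨ ⊡-lowerBlock-mid L T⁻ Ci u⁻ v⁻ wi last l ⟩
      mulRow v Ci l + w * - (wi * mulRow v Ci l)
        ≈⟨ +-congˡ (trans (sym (-‿distribʳ-* w _)) (-‿cong (cancel-w _))) ⟩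
      mulRow v Ci l + - mulRow v Ci l
        ≈⟨ -‿inverseʳ _ ⟩
      0# ∎
    lowerBlock-⊡-lowerBlock⁻¹ last last = trans (⊡-lowerBlock-last L T⁻ Ci u⁻ v⁻ wi last) wwi

    lowerBlock⁻¹-⊡-lowerBlock : L⁻¹ ⊡ L ≈ᴮ 1ᴮ
    lowerBlock⁻¹-⊡-lowerBlock first y =
      trans (lowerBlock-⊡-first T⁻ Ci u⁻ v⁻ wi L y) (reflexive (lowerBlock-first-row T C u v w y))
    lowerBlock⁻¹-⊡-lowerBlock (mid k) first = begin
      (- mulCol Ci T k) * 1# + (mulCol Ci T k + 0# * u)
        ≈⟨ +-cong (*-identityʳ _) (trans (+-congˡ (zeroˡ u)) (+-identityʳ _)) ⟩
      - mulCol Ci T k + mulCol Ci T k  ≈⟨ -‿inverseˡ _ ⟩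
      0# ∎
    lowerBlock⁻¹-⊡-lowerBlock (mid k) (mid l) = begin
      (L⁻¹ ⊡ L) (mid k) (mid l)  ≈⟨ ⊡-lowerBlock-mid L⁻¹ T C u v w (mid k) l ⟩
      mulRow (Ci k) C l + 0# * v l  ≈⟨ +-cong (reflexive (≡.sym (⊠≡mulRow Ci C k l))) (zeroˡ _) ⟩
      (Ci ⊠ C) k l + 0#             ≈⟨ trans (+-identityʳ _) (CiC k l) ⟩
      idM k l ∎
    lowerBlock⁻¹-⊡-lowerBlock (mid k) last = trans (⊡-lowerBlock-last L⁻¹ T C u v w (mid k)) (zeroˡ w)
    lowerBlock⁻¹-⊡-lowerBlock last first = begin
      wi * (- u + D) * 1# + (∑[ s < m ] ((- (wi * mulRow v Ci s)) * T s) + wi * u)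
        ≈⟨ +-cong (trans (*-identityʳ _) (distribˡ wi (- u) D))
                  (+-congʳ (trans (sum-neg-scaled-* wi (mulRow v Ci) T) (-‿cong (*-congˡ (dot-mulRow v Ci T))))) ⟩
      (wi * - u + wi * D) + (- (wi * D) + wi * u)  ≈⟨ +-congˡ (+-comm _ _) ⟩
      (wi * - u + wi * D) + (wi * u + - (wi * D))  ≈⟨ interchange _ _ _ _ ⟩
      (wi * - u + wi * u) + (wi * D + - (wi * D))
        ≈⟨ +-cong (trans (+-congʳ (sym (-‿distribʳ-* wi u))) (-‿inverseˡ _)) (-‿inverseʳ _) ⟩
      0# + 0#                                      ≈⟨ +-identityʳ 0# ⟩
      0# ∎
    lowerBlock⁻¹-⊡-lowerBlock last (mid l) = begin
      (L⁻¹ ⊡ L) last (mid l)  ≈⟨ ⊡-lowerBlock-mid L⁻¹ T C u v w last l ⟩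
      ∑[ s < m ] ((- (wi * mulRow v Ci s)) * C s l) + wi * v l
        ≈⟨ +-congʳ (trans (sum-neg-scaled-* wi (mulRow v Ci) (λ s → C s l))
                          (-‿cong (*-congˡ (mulRow-inverse CiC v l)))) ⟩
      - (wi * v l) + wi * v l  ≈⟨ -‿inverseˡ _ ⟩
      0# ∎
    lowerBlock⁻¹-⊡-lowerBlock last last = trans (⊡-lowerBlock-last L⁻¹ T C u v w last) (trans (*-comm wi w) wwi)

  lowerBlock-inverse : ∀ {m} T {C Ci : Mat Carrier m} u v {w wi} →
                       (C ⊠ Ci) ≈M idM → (Ci ⊠ C) ≈M idM → w * wi ≈ 1# →
                       IsInverse (unblock (lowerBlock T C u v w)) (unblock (lowerBlock⁻¹ T Ci u v wi))
  lowerBlock-inverse T {C} {Ci} u v {w} {wi} CCi CiC wwi =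
    unblock-inverse {A = lowerBlock T C u v w} {lowerBlock⁻¹ T Ci u v wi}
      (lowerBlock-⊡-lowerBlock⁻¹ T u v CCi CiC wwi , lowerBlock⁻¹-⊡-lowerBlock T u v CCi CiC wwi)

  pow-1# : ∀ k → pow 1# k ≈ 1#
  pow-1# zero    = refl
  pow-1# (suc k) = trans (*-identityˡ _) (pow-1# k)

  pow-cong : ∀ k {x y} → x ≈ y → pow x k ≈ pow y k
  pow-cong zero    x≈y = refl
  pow-cong (suc k) x≈y = *-cong x≈y (pow-cong k x≈y)

  φ-lowerBlock : ∀ {m} p' {T T' : Vector Carrier m} {C C' : Mat Carrier m} {u u' v v' w w'} →
                 (∀ k → pow (T k) (suc p') ≈ T' k) → φ (suc p') C ≈M C' → pow u (suc p') ≈ u' →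
                 (∀ l → pow (v l) (suc p') ≈ v' l) → pow w (suc p') ≈ w' →
                 φ (suc p') (unblock (lowerBlock T C u v w)) ≈M unblock (lowerBlock T' C' u' v' w')
  φ-lowerBlock p' {T} {T'} {C} {C'} {u} {u'} {v} {v'} {w} {w'} T≈ C≈ u≈ v≈ w≈ = unblock-cong entry
    where
    entry : (λ y z → pow (lowerBlock T C u v w y z) (suc p')) ≈ᴮ lowerBlock T' C' u' v' w'
    entry first   first   = pow-1# (suc p')
    entry first   (mid l) = zeroˡ _
    entry first   last    = zeroˡ _
    entry (mid k) first   = T≈ k
    entry (mid k) (mid l) = C≈ k l
    entry (mid k) last    = zeroˡ _
    entry last    first   = u≈
    entry last    (mid l) = v≈ l
    entry last    last    = w≈

  lowerBlock-lowerTriangular : ∀ {m} T {C : Mat Carrier m} u v w → LowerTriangular C →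
                               LowerTriangular (unblock (lowerBlock T C u v w))
  lowerBlock-lowerTriangular T {C} u v w lowC = unblock-all (λ i j y → toℕ i ℕ.< toℕ j → y ≈ 0#) _ entry
    where
    entry : ∀ y z → toℕ (fromPart y) ℕ.< toℕ (fromPart z) → lowerBlock T C u v w y z ≈ 0#
    entry first   (mid l) _  = refl
    entry first   last    _  = refl
    entry (mid k) (mid l) lt = lowC k l (fromPart-mid-< lt)
    entry (mid k) last    _  = refl
    entry last    z       lt = ⊥-elim (fromPart-last-≮ z lt)

  inM-Σ₁-bordered : ∀ {m} (Y : BMat m) → (∀ l → Y first (mid l) ≈ 0#) → (∀ k → Y (mid k) last ≈ 0#) →
                    InM (Σ₁ m) (λ k l → Y (mid k) (mid l)) → InM (Σ₁ (suc (suc m))) (unblock Y)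
  inM-Σ₁-bordered {m} Y top right inner = unblock-all (λ i j y → ¬ Σ₁ (suc (suc m)) i j → y ≈ 0#) Y entry
    where
    entry : ∀ y z → ¬ Σ₁ (suc (suc m)) (fromPart y) (fromPart z) → Y y z ≈ 0#
    entry first   first   ∉Σ = ⊥-elim (∉Σ (Σ₁-first-column first))
    entry first   (mid l) _  = top l
    entry first   last    ∉Σ = ⊥-elim (∉Σ Σ₁-corner)
    entry (mid k) first   ∉Σ = ⊥-elim (∉Σ (Σ₁-first-column (mid k)))
    entry (mid k) (mid l) ∉Σ = inner k l (∉Σ ∘ Σ₁-mid)
    entry (mid k) last    _  = right k
    entry last    z       ∉Σ = ⊥-elim (∉Σ (Σ₁-last-row z))

  mulRow-scale : ∀ {m} a (v : Vector Carrier m) (C : Mat Carrier m) l →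
                 mulRow (λ s → a * v s) C l ≈ a * mulRow v C l
  mulRow-scale a v C l =
    trans (sum-cong-≋ λ s → *-assoc a (v s) (C s l)) (sym (*-distribˡ-sum a (λ s → v s * C s l)))

  -- Twisted conjugation of a matrix with invertible corner entry

  borderMinors : ∀ {m} → BMat m → Mat Carrier m
  borderMinors X k l = X first last * X (mid k) (mid l) - X (mid k) last * X first (mid l)

  borderMinors-cong : ∀ {m} {A B : BMat m} → A ≈ᴮ B → borderMinors A ≈M borderMinors B
  borderMinors-cong A≈B k l = +-cong (*-cong (A≈B first last) (A≈B (mid k) (mid l)))
                                     (-‿cong (*-cong (A≈B (mid k) last) (A≈B first (mid l))))

  module BorderedConjugation {m} (X : BMat m) {a' : Carrier} (aa' : X first last * a' ≈ 1#) (c : Mat Carrier m)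
    where

    a : Carrier
    a = X first last

    x₀ xₙ : Vector Carrier m
    x₀ l = X first (mid l)
    xₙ k = X (mid k) last

    minors : Mat Carrier m
    minors = borderMinors X

    clearing : Vector Carrier m
    clearing k = - (mulCol c xₙ k * a')

    Xᴹ : Mat Carrier m
    Xᴹ k l = X (mid k) (mid l)

    a*[a'*z]≈z : ∀ z → a * (a' * z) ≈ z
    a*[a'*z]≈z z = trans (sym (*-assoc a a' z)) (trans (*-congʳ aa') (*-identityˡ z))

    a'*[a*z]≈z : ∀ z → a' * (a * z) ≈ z
    a'*[a*z]≈z z = trans (x*[y*z]≈y*[x*z] a' a z) (a*[a'*z]≈z z)

    ⊠-minors : ∀ k l → (c ⊠ minors) k l ≈ a * mulRow (c k) Xᴹ l - mulCol c xₙ k * x₀ l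
    ⊠-minors k l = begin
      (c ⊠ minors) k l
        ≡⟨ ⊠≡mulRow c minors k l ⟩
      ∑[ s < m ] (c k s * (a * X (mid s) (mid l) + - (xₙ s * x₀ l)))
        ≈⟨ sum-cong-≋ (λ s → distribˡ (c k s) _ _) ⟩
      ∑[ s < m ] (c k s * (a * X (mid s) (mid l)) + c k s * - (xₙ s * x₀ l))
        ≈⟨ ∑-distrib-+ (λ s → c k s * (a * X (mid s) (mid l))) (λ s → c k s * - (xₙ s * x₀ l)) ⟩
      ∑[ s < m ] (c k s * (a * X (mid s) (mid l))) + ∑[ s < m ] (c k s * - (xₙ s * x₀ l))
        ≈⟨ +-cong (trans (sum-cong-≋ λ s → x*[y*z]≈y*[x*z] (c k s) a _)
                         (sym (*-distribˡ-sum a (λ s → c k s * X (mid s) (mid l)))))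
                  (trans (sum-*-negʳ (c k) (λ s → xₙ s * x₀ l))
                         (-‿cong (trans (sum-cong-≋ λ s → sym (*-assoc (c k s) (xₙ s) (x₀ l)))
                                        (sym (*-distribʳ-sum (x₀ l) (λ s → c k s * xₙ s)))))) ⟩
      a * mulRow (c k) Xᴹ l - mulCol c xₙ k * x₀ l ∎

    module _ (β : Vector Carrier m) (γ : Carrier) (T' : Vector Carrier m) (d : Mat Carrier m) where

      private
        P : BMat m
        P = lowerBlock clearing c 0# β γ ⊡ X

        T⁻ v⁻ : Vector Carrier m
        T⁻ k = - mulCol d T' k
        v⁻ l = - (a' * mulRow x₀ d l)

        u⁻ : Carrier
        u⁻ = a' * (- 0# + dot x₀ (mulCol d T'))

        D : BMat m
        D = lowerBlock⁻¹ T' d 0# x₀ a'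

      P-mid-last : ∀ k → P (mid k) last ≈ 0#
      P-mid-last k = begin
        clearing k * a + (mulCol c xₙ k + 0# * X last last)
          ≈⟨ +-cong (trans (sym (-‿distribˡ-* _ a)) (-‿cong (trans (*-assoc _ a' a) (*-congˡ (*-comm a' a)))))
                  (trans (+-congˡ (zeroˡ _)) (+-identityʳ _)) ⟩
        - (mulCol c xₙ k * (a * a')) + mulCol c xₙ k
          ≈⟨ +-congʳ (-‿cong (trans (*-congˡ aa') (*-identityʳ _))) ⟩
        - mulCol c xₙ k + mulCol c xₙ k
          ≈⟨ -‿inverseˡ _ ⟩
        0# ∎

      P-mid-mid : ∀ k l → P (mid k) (mid l) ≈ a' * (c ⊠ minors) k l
      P-mid-mid k l = begin
        clearing k * x₀ l + (mulRow (c k) Xᴹ l + 0# * X last (mid l))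
          ≈⟨ +-cong (sym (-‿distribˡ-* _ (x₀ l))) (trans (+-congˡ (zeroˡ _)) (+-identityʳ _)) ⟩
        - (mulCol c xₙ k * a' * x₀ l) + mulRow (c k) Xᴹ l
          ≈⟨ +-comm _ _ ⟩
        mulRow (c k) Xᴹ l + - (mulCol c xₙ k * a' * x₀ l)
          ≈⟨ +-cong (sym (a'*[a*z]≈z _)) (-‿cong (trans (*-congʳ (*-comm _ a')) (*-assoc a' _ (x₀ l)))) ⟩
        a' * (a * mulRow (c k) Xᴹ l) + - (a' * (mulCol c xₙ k * x₀ l))
          ≈⟨ +-congˡ (-‿distribʳ-* a' _) ⟩
        a' * (a * mulRow (c k) Xᴹ l) + a' * - (mulCol c xₙ k * x₀ l)
          ≈⟨ distribˡ a' _ _ ⟨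
        a' * (a * mulRow (c k) Xᴹ l - mulCol c xₙ k * x₀ l)
          ≈⟨ *-congˡ (⊠-minors k l) ⟨
        a' * (c ⊠ minors) k l ∎

      conjugate-inM : InM (Σ₁ m) ((c ⊠ minors) ⊠ d) → InM (Σ₁ (suc (suc m))) (unblock (P ⊡ D))
      conjugate-inM minors-inM = inM-Σ₁-bordered (P ⊡ D) top right inner
        where
        top : ∀ l → (P ⊡ D) first (mid l) ≈ 0#
        top l = begin
          (P ⊡ D) first (mid l)
            ≈⟨ ⊡-lowerBlock-mid P T⁻ d u⁻ v⁻ a' first l ⟩
          mulRow (λ s → P first (mid s)) d l + P first last * v⁻ l
            ≈⟨ +-cong (sum-cong-≋ λ s → *-congʳ (lowerBlock-⊡-first clearing c 0# β γ X (mid s)))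
                      (trans (*-congʳ (lowerBlock-⊡-first clearing c 0# β γ X last)) (sym (-‿distribʳ-* a _))) ⟩
          mulRow x₀ d l + - (a * (a' * mulRow x₀ d l))
            ≈⟨ +-congˡ (-‿cong (a*[a'*z]≈z _)) ⟩
          mulRow x₀ d l + - mulRow x₀ d l
            ≈⟨ -‿inverseʳ _ ⟩
          0# ∎
        right : ∀ k → (P ⊡ D) (mid k) last ≈ 0#
        right k = trans (⊡-lowerBlock-last P T⁻ d u⁻ v⁻ a' (mid k)) (trans (*-congʳ (P-mid-last k)) (zeroˡ a'))
        inner : InM (Σ₁ m) (λ k l → (P ⊡ D) (mid k) (mid l))
        inner k l ∉Σ = begin
          (P ⊡ D) (mid k) (mid l)
            ≈⟨ ⊡-lowerBlock-mid P T⁻ d u⁻ v⁻ a' (mid k) l ⟩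
          mulRow (λ s → P (mid k) (mid s)) d l + P (mid k) last * v⁻ l
            ≈⟨ +-cong (sum-cong-≋ λ s → *-congʳ (P-mid-mid k s)) (trans (*-congʳ (P-mid-last k)) (zeroˡ _)) ⟩
          mulRow (λ s → a' * (c ⊠ minors) k s) d l + 0#
            ≈⟨ trans (+-identityʳ _) (mulRow-scale a' ((c ⊠ minors) k) d l) ⟩
          a' * mulRow ((c ⊠ minors) k) d l
            ≈⟨ *-congˡ (trans (reflexive (≡.sym (⊠≡mulRow (c ⊠ minors) d k l))) (minors-inM k l ∉Σ)) ⟩
          a' * 0#
            ≈⟨ zeroʳ a' ⟩
          0# ∎

  substP : ∀ {V W : Set} → Poly Carrier V → (V → Poly Carrier W) → Poly Carrier W
  substP (var v) σ = σ v
  substP (con a) σ = con a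
  substP (f ⊕ g) σ = substP f σ ⊕ substP g σ
  substP (f ⊗ g) σ = substP f σ ⊗ substP g σ
  substP (⊝ f)   σ = ⊝ substP f σ

  evalP-substP : ∀ {m n} (f : Poly Carrier (Fin m × Fin m)) (σ : Fin m × Fin m → Poly Carrier (Fin n × Fin n)) x →
                 evalP (substP f σ) x ≈ evalP f (λ k l → evalP (σ (k , l)) x)
  evalP-substP (var (k , l)) σ x = refl
  evalP-substP (con a)       σ x = refl
  evalP-substP (f ⊕ g)       σ x = +-cong (evalP-substP f σ x) (evalP-substP g σ x)
  evalP-substP (f ⊗ g)       σ x = *-cong (evalP-substP f σ x) (evalP-substP g σ x)
  evalP-substP (⊝ f)         σ x = -‿cong (evalP-substP f σ x)

  evalP-cong : ∀ {n} (f : Poly Carrier (Fin n × Fin n)) {x y : Mat Carrier n} → x ≈M y → evalP f x ≈ evalP f y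
  evalP-cong (var (k , l)) x≈y = x≈y k l
  evalP-cong (con a)       x≈y = refl
  evalP-cong (f ⊕ g)       x≈y = +-cong (evalP-cong f x≈y) (evalP-cong g x≈y)
  evalP-cong (f ⊗ g)       x≈y = *-cong (evalP-cong f x≈y) (evalP-cong g x≈y)
  evalP-cong (⊝ f)         x≈y = -‿cong (evalP-cong f x≈y)

  borderMinorsP : ∀ {m} → Fin m × Fin m → Poly Carrier (Fin (suc (suc m)) × Fin (suc (suc m)))
  borderMinorsP (k , l) =
    (var (fromPart first , fromPart last) ⊗ var (fromPart (mid k) , fromPart (mid l))) ⊕
    (⊝ (var (fromPart (mid k) , fromPart last) ⊗ var (fromPart first , fromPart (mid l))))

  *≉0ˡ : ∀ {a b} → ¬ a * b ≈ 0# → ¬ a ≈ 0#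
  *≉0ˡ ab≉0 a≈0 = ab≉0 (trans (*-congʳ a≈0) (zeroˡ _))

  *≉0ʳ : ∀ {a b} → ¬ a * b ≈ 0# → ¬ b ≈ 0#
  *≉0ʳ ab≉0 b≈0 = ab≉0 (trans (*-congˡ b≈0) (zeroʳ _))

  TwistConjugableToΣ₁ : ℕ → ∀ n → Mat Carrier n → Set (c ⊔ ℓ)
  TwistConjugableToΣ₁ p n x =
    ∃ λ b → LowerTriangular b × Invertible b × ∃ λ d → IsInverse (φ p b) d × InM (Σ₁ n) ((b ⊠ x) ⊠ d)

  module FrobeniusTwist (p' : ℕ) (isField : IsField) (root : ∀ a → ∃ λ r → pow r (suc p') ≈ a) where

    private
      p : ℕ
      p = suc p'

      inverse : ∀ a → ¬ a ≈ 0# → ∃ λ a' → a * a' ≈ 1#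
      inverse = proj₂ isField

    twistConjugable-step : ∀ {m} (x : Mat Carrier (suc (suc m))) → ¬ x zero (fromPart last) ≈ 0# →
                           TwistConjugableToΣ₁ p m (borderMinors (blocks x)) → TwistConjugableToΣ₁ p (suc (suc m)) x
    twistConjugable-step {m} x a≉0 (c , lowC , (c⁻¹ , cc⁻¹ , c⁻¹c) , d , (φc-d , d-φc) , minors∈Σ₁) =
      unblock B , lowerBlock-lowerTriangular clearing 0# β γ lowC ,
      (unblock B⁻¹ , lowerBlock-inverse clearing 0# β cc⁻¹ c⁻¹c γγ⁻¹) ,
      unblock D , IsInverse-respˡ {B = unblock D} φB≈ (lowerBlock-inverse T' 0# x₀ φc-d d-φc aa') ,
      InM-resp conjugate≈ (conjugate-inM β γ T' d minors∈Σ₁)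
      where
      X : BMat m
      X = blocks x

      a' : Carrier
      a' = proj₁ (inverse (X first last) a≉0)

      aa' : X first last * a' ≈ 1#
      aa' = proj₂ (inverse (X first last) a≉0)

      open BorderedConjugation X aa' c

      β : Vector Carrier m
      β l = proj₁ (root (x₀ l))

      γ : Carrier
      γ = proj₁ (root a)

      γ≉0 : ¬ γ ≈ 0#
      γ≉0 γ≈0 = a≉0 (trans (sym (proj₂ (root a))) (trans (pow-cong p γ≈0) (zeroˡ _)))

      γ⁻¹ : Carrier
      γ⁻¹ = proj₁ (inverse γ γ≉0)

      γγ⁻¹ : γ * γ⁻¹ ≈ 1#
      γγ⁻¹ = proj₂ (inverse γ γ≉0)

      T' : Vector Carrier m
      T' k = pow (clearing k) p

      B B⁻¹ D : BMat m
      B   = lowerBlock clearing c 0# β γ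
      B⁻¹ = lowerBlock⁻¹ clearing c⁻¹ 0# β γ⁻¹
      D   = lowerBlock⁻¹ T' d 0# x₀ a'

      φB≈ : φ p (unblock B) ≈M unblock (lowerBlock T' (φ p c) 0# x₀ a)
      φB≈ = φ-lowerBlock p' (λ _ → refl) (λ _ _ → refl) (zeroˡ _) (λ l → proj₂ (root (x₀ l))) (proj₂ (root a))

      conjugate≈ : ((unblock B ⊠ x) ⊠ unblock D) ≈M unblock (B ⊡ X ⊡ D)
      conjugate≈ i j = begin
        ((unblock B ⊠ x) ⊠ unblock D) i j
          ≈⟨ ⊠-cong {B = unblock D} (⊠-cong {A = unblock B} (λ _ _ → refl) (λ i j → sym (unblock-blocks x i j)))
                    (λ _ _ → refl) i j ⟩
        ((unblock B ⊠ unblock X) ⊠ unblock D) i j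
          ≈⟨ ⊠-cong {B = unblock D} (unblock-⊡ B X) (λ _ _ → refl) i j ⟩
        (unblock (B ⊡ X) ⊠ unblock D) i j
          ≈⟨ unblock-⊡ (B ⊡ X) D i j ⟩
        unblock (B ⊡ X ⊡ D) i j ∎

    twistConjugable-0 : ∀ x → TwistConjugableToΣ₁ p 0 x
    twistConjugable-0 x = (λ ()) , (λ ()) , ((λ ()) , (λ ()) , (λ ())) , (λ ()) , ((λ ()) , (λ ())) , (λ ())

    twistConjugable-1 : ∀ x → TwistConjugableToΣ₁ p 1 x
    twistConjugable-1 x = one , (λ { zero zero () }) , (one , one-one , one-one) , one , (φone-one , one-φone) , inM
      where
      one : Mat Carrier 1
      one _ _ = 1#
      one-one : (one ⊠ one) ≈M idM
      one-one zero zero = trans (+-identityʳ _) (trans (*-identityˡ 1#) (sym (idM-refl {1} zero)))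
      φone-one : (φ p one ⊠ one) ≈M idM
      φone-one zero zero = trans (+-identityʳ _) (trans (*-identityʳ _) (trans (pow-1# p) (sym (idM-refl {1} zero))))
      one-φone : (one ⊠ φ p one) ≈M idM
      one-φone zero zero = trans (+-identityʳ _) (trans (*-identityˡ _) (trans (pow-1# p) (sym (idM-refl {1} zero))))
      inM : InM (Σ₁ 1) ((one ⊠ x) ⊠ one)
      inM zero zero ∉Σ = ⊥-elim (∉Σ (inj₁ z≤n))

    twistConjugable-on-open : ∀ n → ∃ λ (f : Poly Carrier (Fin n × Fin n)) →
      (∃ λ x → ¬ evalP f x ≈ 0#) × (∀ x → ¬ evalP f x ≈ 0# → TwistConjugableToΣ₁ p n x)
    twistConjugable-on-open zero          = con 1# , ((λ ()) , proj₁ isField) , λ x _ → twistConjugable-0 x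
    twistConjugable-on-open (suc zero)    = con 1# , ((λ _ _ → 1#) , proj₁ isField) , λ x _ → twistConjugable-1 x
    twistConjugable-on-open (suc (suc m)) with twistConjugable-on-open m
    ... | f , (z , fz≉0) , conjugable =
      f' , (W , f'W≉0) ,
      λ x f'x≉0 → twistConjugable-step x (*≉0ˡ (f'x≉0 ∘ trans (evalP-f' x)))
                                          (conjugable _ (*≉0ʳ (f'x≉0 ∘ trans (evalP-f' x))))
      where
      f' : Poly Carrier (Fin (suc (suc m)) × Fin (suc (suc m)))
      f' = var (zero , fromPart last) ⊗ substP f borderMinorsP

      evalP-f' : ∀ x → evalP f' x ≈ x zero (fromPart last) * evalP f (borderMinors (blocks x))
      evalP-f' x = *-congˡ (evalP-substP f borderMinorsP x)

      Wᴮ : BMat m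
      Wᴮ first   last    = 1#
      Wᴮ (mid k) (mid l) = z k l
      Wᴮ _       _       = 0#

      W : Mat Carrier (suc (suc m))
      W = unblock Wᴮ

      minorsW≈z : borderMinors (blocks W) ≈M z
      minorsW≈z k l = trans (borderMinors-cong (blocks-unblock Wᴮ) k l)
        (trans (+-cong (*-identityˡ _) (trans (-‿cong (zeroˡ 0#)) -0#≈0#)) (+-identityʳ _))

      f'W≉0 : ¬ evalP f' W ≈ 0#
      f'W≉0 f'W≈0 = fz≉0 (begin
        evalP f z                                                  ≈⟨ evalP-cong f minorsW≈z ⟨
        evalP f (borderMinors (blocks W))                          ≈⟨ *-identityˡ _ ⟨
        1# * evalP f (borderMinors (blocks W))                     ≈⟨ *-congʳ (blocks-unblock Wᴮ first last) ⟨
        W zero (fromPart last) * evalP f (borderMinors (blocks W))  ≈⟨ evalP-f' W ⟨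
        evalP f' W                                                 ≈⟨ f'W≈0 ⟩
        0#                                                         ∎)

  pow-surjective : IsAlgClosed → ∀ p' a → ∃ λ r → pow r (suc p') ≈ a
  pow-surjective algClosed p' a with algClosed (- a) (replicate p' 0#)
  ... | r , -a+r^p≈0 = r , (begin
    pow r (suc p')  ≈⟨ +-inverseʳ-unique (- a) _ (trans (+-congˡ (*-congˡ (sym (evalMonic-zeros p' r)))) -a+r^p≈0) ⟩
    - - a           ≈⟨ -‿involutive a ⟩
    a               ∎)
    where
    evalMonic-zeros : ∀ k r → evalMonic (replicate k 0#) r ≈ pow r k
    evalMonic-zeros zero    r = refl
    evalMonic-zeros (suc k) r = trans (+-identityˡ _) (*-congˡ (evalMonic-zeros k r))

  Σ₁-isLarge : ∀ p' → IsField → IsAlgClosed → ∀ n → IsLarge (suc p') n (Σ₁ n)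
  Σ₁-isLarge p' isField algClosed n
    with FrobeniusTwist.twistConjugable-on-open p' isField (pow-surjective algClosed p') n
  ... | f , (x , fx≉0) , conjugable = f ∷ [] , (x , here fx≉0) , λ { y (here fy≉0) → conjugable y fy≉0 }

lemma4p3p7 : {c ℓ : Level} (n p : ℕ) → 1 ≤ n → Prime p →
    (k : CommutativeRing c ℓ) → FieldTheory.IsAlgClosureFp k p →
    FieldTheory.IsLarge k p n (Σ₁ n)
lemma4p3p7 n zero     _ p-prime k _                           = ⊥-elim (¬prime[0] p-prime)
lemma4p3p7 n (suc p') _ _       k (isField , _ , algClosed , _) = Σ₁-isLarge k p' isField algClosed n
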